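{- Let $k$ be a positive integer and $T$ a standard $k$-tableau of weight $(1^m)$. For $1\le i\le m$, let $i^{\uparrow}$ and $i^{\downarrow}$ be the highest and lowest cells of $T$ filled with $i$. Then every diagonal of residue $\mathrm{res}(i)$ lying between the diagonal of $i^{\uparrow}$ and the diagonal of $i^{\downarrow}$ contains a cell of $T$ filled with $i$.
   Context: Partitions are drawn in French convention: cell $(i,j)$ lies in the $i$-th row from the bottom and $j$-th column from the left. Hook length of $c=(i,j)\in\lambda$: cells to its right in row $i$ plus cells above it in column $j$ plus one. A $(k+1)$-core is a partition with no cell of hook length $k+1$. The residue of cell $(i,j)$ is $(j-i)\bmod(k+1)$; the diagonal of $(i,j)$ is the set of cells with the same value $j-i$, and has residue $(j-i)\bmod(k+1)$. A standard $k$-tableau of weight $(1^m)$ and shape $\lambda$ (a $(k+1)$-core with $m$ cells of hook length $\le k$) is a filling of $\lambda$ with $1,\dots,m$ such that for each $i$ the cells filled with letters $\le i$ form a $(k+1)$-core $\lambda^{(i)}$, $\lambda^{(i)}/\lambda^{(i-1)}$ is a horizontal strip, and all cells filled with $i$ have the same residue, denoted $\mathrm{res}(i)$. -}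

module Defs where

open import Data.Nat using (ℕ; zero; suc; _+_; _∸_; _≤_; _≤?_; NonZero)
open import Data.Nat.ListAction using (sum)
open import Data.List using (List; []; _∷_; length; map; filter; upTo)
open import Data.Integer.Base using (ℤ; +_; _-_; _%ℕ_)
open import Data.Product using (Σ; _×_)
open import Relation.Binary.PropositionalEquality using (_≡_; _≢_)
open import Function.Bundles using (_⇔_)

-- Partitions: lists of row lengths (bottom row first, French convention),
-- weakly decreasing with positive entries.
data Decreasing : List ℕ → Set where
  nil  : Decreasing []
  one  : ∀ {a} → Decreasing (a ∷ [])
  cons : ∀ {a b l} → b ≤ a → Decreasing (b ∷ l) → Decreasing (a ∷ b ∷ l)

data AllPos : List ℕ → Set where
  nil  : AllPos []
  cons : ∀ {a l} → 1 ≤ a → AllPos l → AllPos (a ∷ l)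

IsPartition : List ℕ → Set
IsPartition λ' = Decreasing λ' × AllPos λ'

-- length of row r (rows indexed from 1, bottom row is row 1); 0 beyond
rowLen : List ℕ → ℕ → ℕ
rowLen []       _             = 0
rowLen (a ∷ _)  1             = a
rowLen (_ ∷ l)  (suc (suc r)) = rowLen l (suc r)
rowLen (_ ∷ _)  zero          = 0

colLen : List ℕ → ℕ → ℕ
colLen λ' j = length (filter (j ≤?_) λ')

-- cell (r , j) : r-th row from the bottom, j-th column from the left (1-indexed)
InShape : List ℕ → ℕ → ℕ → Set
InShape λ' r j = (1 ≤ r) × (1 ≤ j) × (j ≤ rowLen λ' r)

hook : List ℕ → ℕ → ℕ → ℕ
hook λ' r j = (rowLen λ' r ∸ j) + (colLen λ' j ∸ r) + 1

IsCore : ℕ → List ℕ → Set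
IsCore k λ' = ∀ r j → InShape λ' r j → hook λ' r j ≢ suc k

oneTo : ℕ → List ℕ
oneTo n = map suc (upTo n)

kSize : ℕ → List ℕ → ℕ
kSize k λ' = sum (map (λ r → length (filter (λ j → hook λ' r j ≤? k) (oneTo (rowLen λ' r))))
                      (oneTo (length λ')))

diag : ℕ → ℕ → ℤ
diag r j = + j - + r

res : ℕ → ℕ → ℕ → ℕ
res k r j = diag r j %ℕ suc k

record StdKTableau (k m : ℕ) : Set where
  field
    shape     : List ℕ
    fill      : ℕ → ℕ → ℕ
    shapePart : IsPartition shape
    shapeCore : IsCore k shape
    shapeSize : kSize k shape ≡ m
    fillRange : ∀ r j → InShape shape r j → (1 ≤ fill r j) × (fill r j ≤ m)
    chainCore : ∀ i → 1 ≤ i → i ≤ m →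
                Σ (List ℕ) (λ μ → IsPartition μ × IsCore k μ ×
                   (∀ r j → InShape μ r j ⇔ (InShape shape r j × fill r j ≤ i)))
    -- λ^(i)/λ^(i-1) is a horizontal strip: no two cells filled with i in one column
    horizontal : ∀ r r' j → InShape shape r j → InShape shape r' j →
                 fill r j ≡ fill r' j → r ≡ r'
    sameRes : ∀ r j r' j' → InShape shape r j → InShape shape r' j' →
              fill r j ≡ fill r' j' → res k r j ≡ res k r' j'

FilledWith : ∀ {k m} → StdKTableau k m → ℕ → ℕ → ℕ → Set
FilledWith T i r j = InShape (StdKTableau.shape T) r j × StdKTableau.fill T r j ≡ i

-- A cell filled with i is an addable cell of the core λ^(i−1) and, since horizontally
-- adjacent cells have different residues when k ≥ 1, a removable cell of λ^(i).
-- In the abacus of a (k+1)-core a bead k+1 diagonals above a gap would be a cell of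
-- hook length k+1, so gaps propagate upwards and beads downwards in steps of k+1.
-- Hence on every diagonal d of residue res(i) between two cells filled with i,
-- λ^(i−1) has a gap and λ^(i) a bead: the row of λ^(i) ending on d is longer than the
-- same row of λ^(i−1), so its last cell is filled with i and lies on d.
module Submission where

open import Defs
open import Data.Nat using (ℕ; zero; suc; _+_; _*_; _∸_; _≤_; _<_; _≤?_; _<?_; z≤n; s≤s)
open import Data.Nat.Properties
open import Data.Nat.Tactic.RingSolver using (solve-∀)
open import Data.Integer.Base as ℤ using (ℤ; +_; -[1+_]; _-_; 0ℤ; ∣_∣; _%ℕ_; _/ℕ_)
  renaming (_≤_ to _≤ℤ_)
import Data.Integer.Properties as ℤP
import Data.Integer.Tactic.RingSolver as ℤ-Solver
open import Data.Integer.DivMod using (a≡a%ℕn+[a/ℕn]*n)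
open import Data.List using (List; []; _∷_; length)
open import Data.List.Properties using (filter-accept; filter-reject)
open import Data.Product using (Σ; ∃; ∃₂; _×_; _,_; proj₁; proj₂)
open import Data.Sum using (_⊎_; inj₁; inj₂)
open import Data.Empty using (⊥; ⊥-elim)
open import Relation.Nullary using (¬_; Dec; yes; no)
open import Relation.Binary.PropositionalEquality
open import Function.Bundles using (_⇔_; mk⇔; Equivalence)

rowLen-≤head : ∀ {a l} → Decreasing (a ∷ l) → ∀ x → rowLen l x ≤ a
rowLen-≤head {l = []}    _            _             = z≤n
rowLen-≤head {l = _ ∷ _} _            zero          = z≤n
rowLen-≤head {l = _ ∷ _} (cons b≤a _) (suc zero)    = b≤a
rowLen-≤head {l = _ ∷ _} (cons b≤a d) (suc (suc x)) = ≤-trans (rowLen-≤head d (suc x)) b≤a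

Decreasing-tail : ∀ {a l} → Decreasing (a ∷ l) → Decreasing l
Decreasing-tail one        = nil
Decreasing-tail (cons _ d) = d

rowLen-antimono : ∀ {l} → Decreasing l → ∀ {x y} → 1 ≤ x → x ≤ y → rowLen l y ≤ rowLen l x
rowLen-antimono {[]}    _ _ _ = z≤n
rowLen-antimono {_ ∷ _} _ {suc zero}    {suc zero}    _ _ = ≤-refl
rowLen-antimono {_ ∷ _} d {suc zero}    {suc (suc y)} _ _ = rowLen-≤head d (suc y)
rowLen-antimono {_ ∷ _} d {suc (suc x)} {suc (suc y)} _ (s≤s x≤y) =
  rowLen-antimono (Decreasing-tail d) (s≤s z≤n) x≤y

colLen-∷-≤ : ∀ {a l y} → y ≤ a → colLen (a ∷ l) y ≡ suc (colLen l y)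
colLen-∷-≤ y≤a = cong length (filter-accept (_ ≤?_) y≤a)

colLen-> : ∀ {a l y} → Decreasing (a ∷ l) → a < y → colLen (a ∷ l) y ≡ 0
colLen-> {l = []}    _            a<y = cong length (filter-reject (_ ≤?_) (<⇒≱ a<y))
colLen-> {l = _ ∷ _} (cons b≤a d) a<y =
  trans (cong length (filter-reject (_ ≤?_) (<⇒≱ a<y))) (colLen-> d (≤-<-trans b≤a a<y))

≤rowLen⇒≤colLen : ∀ {l} → Decreasing l → ∀ {x y} → 1 ≤ x → 1 ≤ y → y ≤ rowLen l x → x ≤ colLen l y
≤rowLen⇒≤colLen {[]}    _ {y = suc _} _ _ ()
≤rowLen⇒≤colLen {a ∷ l} d {suc zero} {y} _ _ y≤a rewrite colLen-∷-≤ {a} {l} {y} y≤a = s≤s z≤n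
≤rowLen⇒≤colLen {a ∷ l} d {suc (suc x)} {y} _ 1≤y y≤ρ
  rewrite colLen-∷-≤ {a} {l} {y} (≤-trans y≤ρ (rowLen-≤head d (suc x))) =
  s≤s (≤rowLen⇒≤colLen (Decreasing-tail d) (s≤s z≤n) 1≤y y≤ρ)

rowLen<⇒colLen< : ∀ {l} → Decreasing l → ∀ {x y} → 1 ≤ x → rowLen l x < y → colLen l y < x
rowLen<⇒colLen< {[]}    _ 1≤x _ = 1≤x
rowLen<⇒colLen< {a ∷ l} d {suc zero} {y} _ a<y rewrite colLen-> d a<y = s≤s z≤n
rowLen<⇒colLen< {a ∷ l} d {suc (suc x)} {y} _ ρ<y with a <? y
... | yes a<y rewrite colLen-> d a<y = s≤s z≤n
... | no a≮y rewrite colLen-∷-≤ {a} {l} {y} (≮⇒≥ a≮y) =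
  s≤s (rowLen<⇒colLen< (Decreasing-tail d) (s≤s z≤n) ρ<y)

rowLen-mono-⊆ : ∀ {μ ν} → (∀ r j → InShape μ r j → InShape ν r j) → ∀ x → rowLen μ x ≤ rowLen ν x
rowLen-mono-⊆ {[]}    _ zero = z≤n
rowLen-mono-⊆ {_ ∷ _} _ zero = z≤n
rowLen-mono-⊆ {μ} μ⊆ν (suc x) with rowLen μ (suc x) in eq
... | zero  = z≤n
... | suc w = proj₂ (proj₂ (μ⊆ν (suc x) (suc w) (s≤s z≤n , s≤s z≤n , ≤-reflexive (sym eq))))

pos-+³ : ∀ a b c → + (a + b + c) ≡ (+ a ℤ.+ + b) ℤ.+ + c
pos-+³ a b c = trans (ℤP.pos-+ (a + b) c) (cong (ℤ._+ + c) (ℤP.pos-+ a b))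

diag≡diag+⇒ : ∀ a b c d n → diag a b ≡ diag c d ℤ.+ + n → b + c ≡ d + a + n
diag≡diag+⇒ a b c d n eq = ℤP.+-injective (begin
  + (b + c)                                ≡⟨ ℤP.pos-+ b c ⟩
  + b ℤ.+ + c                              ≡⟨ add-back (+ a) (+ b) (+ c) ⟩
  (diag a b ℤ.+ + a) ℤ.+ + c               ≡⟨ cong (λ e → (e ℤ.+ + a) ℤ.+ + c) eq ⟩
  ((diag c d ℤ.+ + n) ℤ.+ + a) ℤ.+ + c     ≡⟨ cancel (+ a) (+ c) (+ d) (+ n) ⟩
  (+ d ℤ.+ + a) ℤ.+ + n                    ≡⟨ pos-+³ d a n ⟨
  + (d + a + n)                            ∎)
  where
  open ≡-Reasoning
  add-back : ∀ a b c → b ℤ.+ c ≡ ((b - a) ℤ.+ a) ℤ.+ c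
  add-back = ℤ-Solver.solve-∀
  cancel : ∀ a c d n → (((d - c) ℤ.+ n) ℤ.+ a) ℤ.+ c ≡ (d ℤ.+ a) ℤ.+ n
  cancel = ℤ-Solver.solve-∀

≡+⇒diag≡diag+ : ∀ {a b c d} n → b + c ≡ d + a + n → diag a b ≡ diag c d ℤ.+ + n
≡+⇒diag≡diag+ {a} {b} {c} {d} n eq = begin
  + b - + a                                ≡⟨ shift (+ a) (+ b) (+ c) ⟩
  (+ b ℤ.+ + c) - (+ a ℤ.+ + c)            ≡⟨ cong (_- (+ a ℤ.+ + c)) lifted ⟩
  ((+ d ℤ.+ + a) ℤ.+ + n) - (+ a ℤ.+ + c)  ≡⟨ cancel (+ a) (+ c) (+ d) (+ n) ⟩
  (+ d - + c) ℤ.+ + n                      ∎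
  where
  open ≡-Reasoning
  lifted : + b ℤ.+ + c ≡ (+ d ℤ.+ + a) ℤ.+ + n
  lifted = trans (sym (ℤP.pos-+ b c)) (trans (cong +_ eq) (pos-+³ d a n))
  shift : ∀ a b c → b - a ≡ (b ℤ.+ c) - (a ℤ.+ c)
  shift = ℤ-Solver.solve-∀
  cancel : ∀ a c d n → ((d ℤ.+ a) ℤ.+ n) - (a ℤ.+ c) ≡ (d - c) ℤ.+ n
  cancel = ℤ-Solver.solve-∀

≡⇒diag≡diag : ∀ {a b c d} → b + c ≡ d + a → diag a b ≡ diag c d
≡⇒diag≡diag {a} {b} {c} {d} eq =
  trans (≡+⇒diag≡diag+ {a} {b} {c} {d} 0 (trans eq (sym (+-identityʳ (d + a)))))
        (ℤP.+-identityʳ _)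

diag-surjective : ∀ p → ∃₂ λ r j → diag r j ≡ p
diag-surjective (+ j)      = 0 , j , ℤP.+-identityʳ (+ j)
diag-surjective -[1+ r ]   = suc r , 0 , refl

%ℕ-≡⇒≡+* : ∀ {x y} n → x ≤ℤ y → x %ℕ suc n ≡ y %ℕ suc n → ∃ λ t → y ≡ x ℤ.+ + (t * suc n)
%ℕ-≡⇒≡+* {x} {y} n x≤y x%≡y% = ∣ q ∣ , (begin
  y                      ≡⟨ split x y ⟩
  x ℤ.+ (y - x)          ≡⟨ cong (λ e → x ℤ.+ e) y-x≡q*N ⟩
  x ℤ.+ q ℤ.* N          ≡⟨ cong (λ e → x ℤ.+ e ℤ.* N) (ℤP.0≤i⇒+∣i∣≡i 0≤q) ⟨
  x ℤ.+ + ∣ q ∣ ℤ.* N    ≡⟨ cong (λ e → x ℤ.+ e) (ℤP.pos-* ∣ q ∣ (suc n)) ⟨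
  x ℤ.+ + (∣ q ∣ * suc n) ∎)
  where
  open ≡-Reasoning
  N = + suc n
  r = + (x %ℕ suc n)
  q = y /ℕ suc n - x /ℕ suc n
  split : ∀ x y → y ≡ x ℤ.+ (y - x)
  split = ℤ-Solver.solve-∀
  cancel : ∀ r a b n → (r ℤ.+ a ℤ.* n) - (r ℤ.+ b ℤ.* n) ≡ (a - b) ℤ.* n
  cancel = ℤ-Solver.solve-∀
  y≡r+… : y ≡ r ℤ.+ y /ℕ suc n ℤ.* N
  y≡r+… = trans (a≡a%ℕn+[a/ℕn]*n y (suc n)) (cong (λ s → + s ℤ.+ y /ℕ suc n ℤ.* N) (sym x%≡y%))
  y-x≡q*N : y - x ≡ q ℤ.* N
  y-x≡q*N = trans (cong₂ _-_ y≡r+… (a≡a%ℕn+[a/ℕn]*n x (suc n)))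
                  (cancel r (y /ℕ suc n) (x /ℕ suc n) N)
  0≤q : 0ℤ ≤ℤ q
  0≤q = ℤP.*-cancelʳ-≤-pos 0ℤ q N (subst (0ℤ ≤ℤ_) y-x≡q*N (ℤP.i≤j⇒0≤j-i x≤y))

-- If row x ends n diagonals above the cell topping column y, they meet in a cell of hook length n.
hook-from-boundary : ∀ {l} → Decreasing l → ∀ {x y n} → 1 ≤ x → 1 ≤ y →
  rowLen l x + suc (colLen l y) ≡ y + x + n → InShape l x y × hook l x y ≡ n
hook-from-boundary {l} d {x} {y} {n} 1≤x 1≤y eq with y ≤? rowLen l x
... | no y≰ρ = ⊥-elim (<⇒≱ ρ+1+c<y+x (≤-trans (m≤m+n (y + x) n) (≤-reflexive (sym eq))))
  where
  ρ+1+c<y+x : rowLen l x + suc (colLen l y) < y + x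
  ρ+1+c<y+x = +-mono-≤ (≰⇒> y≰ρ) (rowLen<⇒colLen< d 1≤x (≰⇒> y≰ρ))
... | yes y≤ρ = (1≤x , 1≤y , y≤ρ) , +-cancelʳ-≡ (y + x) _ _ hook+y+x
  where
  open ≡-Reasoning
  ρ = rowLen l x
  c = colLen l y
  x≤c : x ≤ c
  x≤c = ≤rowLen⇒≤colLen d 1≤x 1≤y y≤ρ
  hook+y+x : hook l x y + (y + x) ≡ n + (y + x)
  hook+y+x = begin
    (ρ ∸ y) + (c ∸ x) + 1 + (y + x)   ≡⟨ interchange (ρ ∸ y) (c ∸ x) y x ⟩
    ((ρ ∸ y) + y) + suc ((c ∸ x) + x) ≡⟨ cong₂ (λ a b → a + suc b) (m∸n+n≡m y≤ρ) (m∸n+n≡m x≤c) ⟩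
    ρ + suc c                         ≡⟨ eq ⟩
    y + x + n                         ≡⟨ +-comm (y + x) n ⟩
    n + (y + x)                       ∎
    where
    interchange : ∀ a b y x → a + b + 1 + (y + x) ≡ (a + y) + suc (b + x)
    interchange = solve-∀

-- The abacus of l: a bead on diagonal p when a row of l ends on p, a gap when the
-- cell just above a column of l lies on p.
Bead : List ℕ → ℤ → Set
Bead l p = Σ ℕ λ x → 1 ≤ x × diag x (rowLen l x) ≡ p

Gap : List ℕ → ℤ → Set
Gap l p = Σ ℕ λ y → 1 ≤ y × diag (suc (colLen l y)) y ≡ p

descend : ∀ {P : ℕ → Set} → (∀ n → Dec (P n)) → ∀ n → P n →
  Σ ℕ λ z → P z × (∀ {z′} → z ≡ suc z′ → ¬ P z′)
descend P? zero    Pn = zero , Pn , λ ()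
descend P? (suc n) Pn with P? n
... | yes Pn′ = descend P? n Pn′
... | no ¬Pn′ = suc n , Pn , λ { refl → ¬Pn′ }

colLen≡ : ∀ {l} → Decreasing l → ∀ {y z} → 1 ≤ y → rowLen l (suc z) < y →
  (∀ {z′} → z ≡ suc z′ → y ≤ rowLen l z) → colLen l y ≡ z
colLen≡ d {y} {zero}    _   ρ<y _       = n<1⇒n≡0 (rowLen<⇒colLen< d (s≤s z≤n) ρ<y)
colLen≡ d {y} {suc z′} 1≤y ρ<y y≤below =
  ≤-antisym (≤-pred (rowLen<⇒colLen< d (s≤s z≤n) ρ<y))
            (≤rowLen⇒≤colLen d (s≤s z≤n) 1≤y (y≤below refl))

-- Descend to the lowest row ending weakly left of diagonal p: either it ends on p, or the
-- column crossing p stops just below it.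
bead-or-gap : ∀ {l} → Decreasing l → ∀ p → Bead l p ⊎ Gap l p
bead-or-gap {l} d p with diag-surjective p
... | r₀ , j₀ , refl with descend RowEndsBelow? (rowLen l 1 + r₀) start
  where
  RowEndsBelow : ℕ → Set
  RowEndsBelow z = rowLen l (suc z) + r₀ ≤ j₀ + suc z
  RowEndsBelow? : ∀ z → Dec (RowEndsBelow z)
  RowEndsBelow? z = _ ≤? _
  start : RowEndsBelow (rowLen l 1 + r₀)
  start = ≤-trans (+-monoˡ-≤ r₀ (rowLen-antimono d (s≤s z≤n) (s≤s z≤n)))
                  (≤-trans (n≤1+n _) (m≤n+m _ j₀))
... | z , ends , ¬below with m≤n⇒m<n∨m≡n ends
... | inj₂ eq = inj₁ (suc z , s≤s z≤n , ≡⇒diag≡diag {suc z} {c = r₀} {j₀} eq)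
... | inj₁ lt = inj₂ (y , ≤-trans (s≤s z≤n) ρ<y , column-top)
  where
  y = j₀ + suc z ∸ r₀
  y+r₀ : y + r₀ ≡ j₀ + suc z
  y+r₀ = m∸n+n≡m (≤-trans (m≤n+m r₀ _) (<⇒≤ lt))
  ρ<y : rowLen l (suc z) < y
  ρ<y = +-cancelʳ-< r₀ _ _ (subst (rowLen l (suc z) + r₀ <_) (sym y+r₀) lt)
  y≤below : ∀ {z′} → z ≡ suc z′ → y ≤ rowLen l z
  y≤below {z′} refl = +-cancelʳ-≤ r₀ _ _ (begin
    y + r₀                 ≡⟨ y+r₀ ⟩
    j₀ + suc z             ≡⟨ +-suc j₀ z ⟩
    suc (j₀ + z)           ≤⟨ ≰⇒> (¬below refl) ⟩
    rowLen l z + r₀        ∎)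
    where open ≤-Reasoning
  colLen-y : colLen l y ≡ z
  colLen-y = colLen≡ d (≤-trans (s≤s z≤n) ρ<y) ρ<y y≤below
  column-top : diag (suc (colLen l y)) y ≡ diag r₀ j₀
  column-top = trans (cong (λ c → diag (suc c) y) colLen-y) (≡⇒diag≡diag {suc z} {c = r₀} {j₀} y+r₀)

¬bead×gap : ∀ {l} → Decreasing l → ∀ {p} → Bead l p → Gap l p → ⊥
¬bead×gap {l} d (x , 1≤x , row-end) (y , 1≤y , column-top) =
  m+1+n≢0 _ (proj₂ (hook-from-boundary d 1≤x 1≤y
    (diag≡diag+⇒ x (rowLen l x) (suc (colLen l y)) y 0
      (trans row-end (trans (sym column-top) (sym (ℤP.+-identityʳ _)))))))

module _ {k l} (d : Decreasing l) (core : IsCore k l) where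

  ¬bead-above-gap : ∀ {p} → Bead l (p ℤ.+ + suc k) → Gap l p → ⊥
  ¬bead-above-gap (x , 1≤x , row-end) (y , 1≤y , column-top) = core x y in-shape hook≡
    where
    in-shape×hook≡ = hook-from-boundary d 1≤x 1≤y
      (diag≡diag+⇒ x (rowLen l x) (suc (colLen l y)) y (suc k)
        (trans row-end (cong (ℤ._+ + suc k) (sym column-top))))
    in-shape = proj₁ in-shape×hook≡
    hook≡ = proj₂ in-shape×hook≡

  gap-step : ∀ p → Gap l p → Gap l (p ℤ.+ + suc k)
  gap-step p gap with bead-or-gap d (p ℤ.+ + suc k)
  ... | inj₁ bead = ⊥-elim (¬bead-above-gap bead gap)
  ... | inj₂ gap′ = gap′

  bead-step : ∀ p → Bead l (p ℤ.+ + suc k) → Bead l p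
  bead-step p bead with bead-or-gap d p
  ... | inj₁ bead′ = bead′
  ... | inj₂ gap   = ⊥-elim (¬bead-above-gap bead gap)

+-pos-*-suc : ∀ p n t → p ℤ.+ + (suc t * n) ≡ (p ℤ.+ + n) ℤ.+ + (t * n)
+-pos-*-suc p n t =
  trans (cong (λ e → p ℤ.+ e) (ℤP.pos-+ n (t * n))) (sym (ℤP.+-assoc p (+ n) (+ (t * n))))

iterate-up : ∀ {P : ℤ → Set} n → (∀ p → P p → P (p ℤ.+ + n)) → ∀ t p → P p → P (p ℤ.+ + (t * n))
iterate-up {P} n step zero    p Pp = subst P (sym (ℤP.+-identityʳ p)) Pp
iterate-up {P} n step (suc t) p Pp =
  subst P (sym (+-pos-*-suc p n t)) (iterate-up n step t (p ℤ.+ + n) (step p Pp))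

iterate-down : ∀ {P : ℤ → Set} n → (∀ p → P (p ℤ.+ + n) → P p) → ∀ t p → P (p ℤ.+ + (t * n)) → P p
iterate-down {P} n step zero    p Pp = subst P (ℤP.+-identityʳ p) Pp
iterate-down {P} n step (suc t) p Pp =
  step p (iterate-down n step t (p ℤ.+ + n) (subst P (+-pos-*-suc p n t) Pp))

res-suc≢ : ∀ {k} → 1 ≤ k → ∀ r j → res k r (suc j) ≢ res k r j
res-suc≢ {k} 1≤k r j same-res = n>0⇒n≢0 1≤k (suc-injective (m*n≡1⇒n≡1 t (suc k) (sym 1≡t*n)))
  where
  next : diag r (suc j) ≡ diag r j ℤ.+ + 1
  next = ≡+⇒diag≡diag+ {r} {suc j} {r} {j} 1 (sym (+-comm (j + r) 1))
  multiple = %ℕ-≡⇒≡+* k (ℤP.i≤i+j (diag r j) (+ 1)) (trans (sym same-res) (cong (_%ℕ suc k) next))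
  t = proj₁ multiple
  drop : ∀ x a → a ≡ (x ℤ.+ a) - x
  drop = ℤ-Solver.solve-∀
  1≡t*n : 1 ≡ t * suc k
  1≡t*n = ℤP.+-injective (begin
    + 1                                   ≡⟨ drop (diag r j) (+ 1) ⟩
    (diag r j ℤ.+ + 1) - diag r j         ≡⟨ cong (_- diag r j) (proj₂ multiple) ⟩
    (diag r j ℤ.+ + (t * suc k)) - diag r j ≡⟨ drop (diag r j) (+ (t * suc k)) ⟨
    + (t * suc k)                         ∎)
    where open ≡-Reasoning

InShape-below : ∀ {l} → Decreasing l → ∀ {r j} → 1 ≤ r → InShape l (suc r) j → InShape l r j
InShape-below d 1≤r (_ , 1≤j , j≤ρ) = 1≤r , 1≤j , ≤-trans j≤ρ (rowLen-antimono d 1≤r (n≤1+n _))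

module _ {k m} (T : StdKTableau k m) where
  open StdKTableau T

  record Stage (n : ℕ) : Set where
    field
      cells      : List ℕ
      decreasing : Decreasing cells
      core       : IsCore k cells
      ∈⇔         : ∀ r j → InShape cells r j ⇔ (InShape shape r j × fill r j ≤ n)

  stage : ∀ n → n ≤ m → Stage n
  stage zero _ = record
    { cells = [] ; decreasing = nil ; core = λ { _ (suc _) (_ , _ , ()) }
    ; ∈⇔ = λ r j → mk⇔ (λ { (_ , s≤s _ , ()) })
                       (λ (in-shape , fill≤0) →
                          ⊥-elim (<⇒≱ (proj₁ (fillRange r j in-shape)) fill≤0)) }
  stage (suc n) n<m with chainCore (suc n) (s≤s z≤n) n<m
  ... | μ , (d , _) , c , iff = record { cells = μ ; decreasing = d ; core = c ; ∈⇔ = iff }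

  module Letter (n : ℕ) (n<m : suc n ≤ m) where
    open Equivalence
    μ = stage n (≤-trans (n≤1+n n) n<m)
    ν = stage (suc n) n<m
    module μ = Stage μ
    module ν = Stage ν

    filled⇒∈ν : ∀ {r j} → FilledWith T (suc n) r j → InShape ν.cells r j
    filled⇒∈ν {r} {j} (in-shape , filled) = from (ν.∈⇔ r j) (in-shape , ≤-reflexive filled)

    filled⇒∉μ : ∀ {r j} → FilledWith T (suc n) r j → ¬ InShape μ.cells r j
    filled⇒∉μ {r} {j} (_ , filled) in-μ = 1+n≰n (subst (_≤ n) filled (proj₂ (to (μ.∈⇔ r j) in-μ)))

    ∈ν∖μ⇒filled : ∀ {r j} → InShape ν.cells r j → ¬ InShape μ.cells r j → FilledWith T (suc n) r j
    ∈ν∖μ⇒filled {r} {j} in-ν ∉μ =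
      in-shape , ≤-antisym fill≤ (≰⇒> λ fill≤n → ∉μ (from (μ.∈⇔ r j) (in-shape , fill≤n)))
      where
      in-shape = proj₁ (to (ν.∈⇔ r j) in-ν)
      fill≤ = proj₂ (to (ν.∈⇔ r j) in-ν)

    μ⊆ν : ∀ r j → InShape μ.cells r j → InShape ν.cells r j
    μ⊆ν r j in-μ with to (μ.∈⇔ r j) in-μ
    ... | in-shape , fill≤n = from (ν.∈⇔ r j) (in-shape , ≤-trans fill≤n (n≤1+n n))

    ≤suc-colLen : ∀ {r j} → FilledWith T (suc n) r j → r ≤ suc (colLen μ.cells j)
    ≤suc-colLen {zero}        _ = z≤n
    ≤suc-colLen {suc zero}    _ = s≤s z≤n
    ≤suc-colLen {suc (suc r)} {j} A@((_ , 1≤j , _) , filled) =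
      s≤s (≤rowLen⇒≤colLen μ.decreasing (s≤s z≤n) 1≤j (proj₂ (proj₂ below-in-μ)))
      where
      below-in-ν = InShape-below ν.decreasing (s≤s z≤n) (filled⇒∈ν A)
      below-in-shape = proj₁ (to (ν.∈⇔ (suc r) j) below-in-ν)
      below-not-filled : fill (suc r) j ≢ suc n
      below-not-filled eq =
        1+n≢n (sym (horizontal _ _ j below-in-shape (proj₁ A) (trans eq (sym filled))))
      below-in-μ : InShape μ.cells (suc r) j
      below-in-μ = from (μ.∈⇔ (suc r) j) (below-in-shape ,
        ≤-pred (≤∧≢⇒< (proj₂ (to (ν.∈⇔ (suc r) j) below-in-ν)) below-not-filled))

    addable-gap : ∀ {r j} → FilledWith T (suc n) r j → Gap μ.cells (diag r j)
    addable-gap {r} {j} A@((1≤r , 1≤j , _) , _) = j , 1≤j , cong (λ r′ → diag r′ j) column-top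
      where
      column-top : suc (colLen μ.cells j) ≡ r
      column-top = ≤-antisym
        (rowLen<⇒colLen< μ.decreasing 1≤r (≰⇒> λ j≤ρ → filled⇒∉μ A (1≤r , 1≤j , j≤ρ)))
        (≤suc-colLen A)

    removable-bead : 1 ≤ k → ∀ {r j} → FilledWith T (suc n) r j → Bead ν.cells (diag r j)
    removable-bead 1≤k {r} {j} B@((1≤r , 1≤j , _) , filled) = r , 1≤r , cong (diag r) row-end
      where
      right-filled : j < rowLen ν.cells r → FilledWith T (suc n) r (suc j)
      right-filled j<ρ = ∈ν∖μ⇒filled (1≤r , s≤s z≤n , j<ρ)
        λ (_ , _ , 1+j≤ρ′) → filled⇒∉μ B (1≤r , 1≤j , ≤-trans (n≤1+n j) 1+j≤ρ′)
      row-end : rowLen ν.cells r ≡ j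
      row-end = ≤-antisym
        (≮⇒≥ λ j<ρ → let (right-in-shape , right-fill) = right-filled j<ρ in
          res-suc≢ 1≤k r j
            (sameRes r (suc j) r j right-in-shape (proj₁ B) (trans right-fill (sym filled))))
        (proj₂ (proj₂ (filled⇒∈ν B)))

    filled-on-diagonal : ∀ {p} → Gap μ.cells p → Bead ν.cells p →
      ∃₂ λ r j → FilledWith T (suc n) r j × diag r j ≡ p
    filled-on-diagonal {p} gap (s , 1≤s , row-end) =
      s , rowLen ν.cells s ,
      ∈ν∖μ⇒filled (1≤s , ≤-trans (s≤s z≤n) μ<ν , ≤-refl) (λ (_ , _ , w≤) → <⇒≱ μ<ν w≤) ,
      row-end
      where
      μ<ν : rowLen μ.cells s < rowLen ν.cells s
      μ<ν = ≤∧≢⇒< (rowLen-mono-⊆ {μ.cells} {ν.cells} μ⊆ν s)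
        λ same → ¬bead×gap μ.decreasing
          (s , 1≤s , subst (λ w → diag s w ≡ p) (sym same) row-end) gap

  filled-between : 1 ≤ k → ∀ {i ra ja rb jb d} → 1 ≤ i → i ≤ m →
    FilledWith T i ra ja → FilledWith T i rb jb →
    d %ℕ suc k ≡ res k ra ja → diag ra ja ≤ℤ d → d ≤ℤ diag rb jb →
    ∃₂ λ r j → FilledWith T i r j × diag r j ≡ d
  filled-between 1≤k {suc n} {ra} {ja} {rb} {jb} {d} _ n<m A B d-res A≤d d≤B =
    filled-on-diagonal gap bead
    where
    open Letter n n<m
    from-A = %ℕ-≡⇒≡+* k A≤d (sym d-res)
    same-res = sameRes ra ja rb jb (proj₁ A) (proj₁ B) (trans (proj₂ A) (sym (proj₂ B)))
    from-d = %ℕ-≡⇒≡+* k d≤B (trans d-res same-res)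
    gap = subst (Gap μ.cells) (sym (proj₂ from-A))
      (iterate-up (suc k) (gap-step {l = μ.cells} μ.decreasing μ.core) (proj₁ from-A) (diag ra ja)
        (addable-gap A))
    bead = iterate-down (suc k) (bead-step {l = ν.cells} ν.decreasing ν.core) (proj₁ from-d) d
      (subst (Bead ν.cells) (proj₂ from-d) (removable-bead 1≤k B))

lemma6p7 : (k m : ℕ) → 1 ≤ k → (T : StdKTableau k m) → (i : ℕ) → 1 ≤ i → i ≤ m →
    (ru ju rd jd : ℕ) →
    FilledWith T i ru ju → (∀ r j → FilledWith T i r j → r ≤ ru) →
    FilledWith T i rd jd → (∀ r j → FilledWith T i r j → rd ≤ r) →
    (d : ℤ) → d %ℕ suc k ≡ res k ru ju →
    ((diag ru ju ≤ℤ d × d ≤ℤ diag rd jd) ⊎ (diag rd jd ≤ℤ d × d ≤ℤ diag ru ju)) →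
    Σ ℕ (λ r → Σ ℕ (λ j → FilledWith T i r j × diag r j ≡ d))
lemma6p7 k m 1≤k T i 1≤i i≤m ru ju rd jd U _ D _ d d-res (inj₁ (U≤d , d≤D)) =
  filled-between T 1≤k 1≤i i≤m U D d-res U≤d d≤D
lemma6p7 k m 1≤k T i 1≤i i≤m ru ju rd jd U _ D _ d d-res (inj₂ (D≤d , d≤U)) =
  filled-between T 1≤k 1≤i i≤m D U (trans d-res same-res) D≤d d≤U
  where
  same-res =
    StdKTableau.sameRes T ru ju rd jd (proj₁ U) (proj₁ D) (trans (proj₂ U) (sym (proj₂ D)))
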